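{- There exist infinitely many positive integers $n$ such that $4n^2-1$ is square-free and $\varepsilon:=2n+\sqrt{4n^2-1}$ is the fundamental unit of the real quadratic field $\mathbb{Q}(\sqrt{4n^2-1})$. -}

module Defs where

open import Data.Nat as ℕ using (ℕ)
open import Data.Nat.Divisibility using (_∣_)
open import Data.Integer as ℤ using (ℤ; +_; _+_; _*_; _-_; -_)
open import Data.Product using (_×_; _,_; ∃)
open import Data.Sum using (_⊎_)
open import Relation.Binary.PropositionalEquality using (_≡_)
open import Relation.Nullary using (¬_)

SquareFree : ℕ → Set
SquareFree m = ∀ p → p ℕ.* p ∣ m → p ≡ 1

-- Elements a + b√d of the order ℤ[√d], represented by the pair (a , b).
ℤ√ : Set
ℤ√ = ℤ × ℤ

one√ : ℤ√
one√ = (+ 1 , + 0)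

mul√ : ℤ → ℤ√ → ℤ√ → ℤ√
mul√ d (a , b) (c , e) = (a * c + d * b * e , a * e + b * c)

sub√ : ℤ√ → ℤ√ → ℤ√
sub√ (a , b) (c , e) = (a - c , b - e)

IsUnit : ℤ → ℤ√ → Set
IsUnit d x = ∃ λ y → mul√ d x y ≡ one√

-- The real number a + b√d is > 0 (for d > 0 not a perfect square),
-- decided by integer arithmetic.
Pos : ℤ → ℤ√ → Set
Pos d (a , b) =
    (+ 0 ℤ.≤ a × + 0 ℤ.≤ b × ¬ (a ≡ + 0 × b ≡ + 0))
  ⊎ (+ 0 ℤ.< a × b ℤ.< + 0 × d * b * b ℤ.< a * a)
  ⊎ (a ℤ.< + 0 × + 0 ℤ.< b × a * a ℤ.< d * b * b)

_>[_]_ : ℤ√ → ℤ → ℤ√ → Set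
x >[ d ] y = Pos d (sub√ x y)

IsFundamentalUnit : ℤ → ℤ√ → Set
IsFundamentalUnit d ε =
  IsUnit d ε × ε >[ d ] one√ ×
  (∀ u → IsUnit d u → u >[ d ] one√ → ¬ (ε >[ d ] u))

dOf : ℕ → ℕ
dOf n = 4 ℕ.* n ℕ.* n ℕ.∸ 1

εOf : ℕ → ℤ√
εOf n = (+ (2 ℕ.* n) , + 1)

{-# OPTIONS --safe #-}
module Submission where

-- Take n = k + 1, so that 4n² - 1 = (2k + 1)(2k + 3) is a product of two coprime odd
-- numbers; it is squarefree as soon as neither factor is divisible by the square of an
-- odd q ≥ 3.  If both factors are below (2P + 3)², only q = 3, 5, …, 2P + 1 matter.  In a
-- window of N consecutive k each of these 2P conditions fails for at most 1 + N/q² values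
-- of k, and Σ 1/(2i + 3)² < Σ 1/(4(i + 1)(i + 2)) < 1/4, so at most 2P + N/2 < N values
-- are excluded when N = 4(P + 1).
--
-- A unit a + b√d > 1 of norm ±1 has a, b ≥ 1.  If it were also below w + √d, d = w² - 1,
-- then a < w, and then a² - d b² ≤ (w - 1)² - (w² - 1) < -1, contradicting the norm.

open import Defs
open import Data.Nat using (ℕ)

module Sums where

  open import Data.Nat
  open import Data.Nat.Properties
  open import Data.Nat.Tactic.RingSolver using (solve-∀)
  open import Data.Product using (∃; _×_; _,_)
  open import Data.Sum using (inj₁; inj₂)
  open import Relation.Binary.PropositionalEquality

  ∑< : ℕ → (ℕ → ℕ) → ℕ
  ∑< zero    f = 0
  ∑< (suc n) f = ∑< n f + f n

  infixl 10 ∑<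
  syntax ∑< n (λ j → e) = ∑[ j < n ] e

  ∑-cong : ∀ {f g : ℕ → ℕ} n → (∀ j → f j ≡ g j) → ∑[ j < n ] f j ≡ ∑[ j < n ] g j
  ∑-cong zero    f≗g = refl
  ∑-cong (suc n) f≗g = cong₂ _+_ (∑-cong n f≗g) (f≗g n)

  ∑-mono-≤ : ∀ {f g : ℕ → ℕ} n → (∀ j → j < n → f j ≤ g j) → ∑[ j < n ] f j ≤ ∑[ j < n ] g j
  ∑-mono-≤ zero    f≤g = z≤n
  ∑-mono-≤ (suc n) f≤g = +-mono-≤ (∑-mono-≤ n (λ j j<n → f≤g j (m<n⇒m<1+n j<n))) (f≤g n ≤-refl)

  ∑-const : ∀ n c → ∑[ j < n ] c ≡ n * c
  ∑-const zero    c = refl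
  ∑-const (suc n) c = trans (cong (_+ c) (∑-const n c)) (+-comm (n * c) c)

  ∑-distrib-+ : ∀ (f g : ℕ → ℕ) n → ∑[ j < n ] (f j + g j) ≡ ∑[ j < n ] f j + ∑[ j < n ] g j
  ∑-distrib-+ f g zero    = refl
  ∑-distrib-+ f g (suc n) = trans (cong (_+ (f n + g n)) (∑-distrib-+ f g n))
                                  (interchange (∑[ j < n ] f j) (∑[ j < n ] g j) (f n) (g n))
    where
    interchange : ∀ a b c d → (a + b) + (c + d) ≡ (a + c) + (b + d)
    interchange = solve-∀

  ∑-comm : ∀ (h : ℕ → ℕ → ℕ) m n → ∑[ i < m ] ∑[ j < n ] h i j ≡ ∑[ j < n ] ∑[ i < m ] h i j
  ∑-comm h zero    n = sym (trans (∑-const n 0) (*-zeroʳ n))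
  ∑-comm h (suc m) n = trans (cong (_+ ∑[ j < n ] h m j) (∑-comm h m n))
                             (sym (∑-distrib-+ (λ j → ∑[ i < m ] h i j) (h m) n))

  ∑-++ : ∀ (f : ℕ → ℕ) m n → ∑[ j < m + n ] f j ≡ ∑[ j < m ] f j + ∑[ j < n ] f (m + j)
  ∑-++ f m zero    = trans (cong (λ k → ∑< k f) (+-identityʳ m)) (sym (+-identityʳ _))
  ∑-++ f m (suc n) = begin
    ∑[ j < m + suc n ] f j                              ≡⟨ cong (λ k → ∑< k f) (+-suc m n) ⟩
    ∑[ j < m + n ] f j + f (m + n)                      ≡⟨ cong (_+ f (m + n)) (∑-++ f m n) ⟩
    ∑[ j < m ] f j + ∑[ j < n ] f (m + j) + f (m + n)   ≡⟨ +-assoc (∑[ j < m ] f j) _ _ ⟩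
    ∑[ j < m ] f j + ∑[ j < suc n ] f (m + j)           ∎
    where open ≡-Reasoning

  ∑-≤-longer : ∀ (f : ℕ → ℕ) {m n} → m ≤ n → ∑[ j < m ] f j ≤ ∑[ j < n ] f j
  ∑-≤-longer f {m} m≤n =
    subst (λ k → ∑[ j < m ] f j ≤ ∑< k f) (m+[n∸m]≡n m≤n)
          (subst (∑[ j < m ] f j ≤_) (sym (∑-++ f m _)) (m≤m+n _ _))

  ≡0⇒∑≡0 : ∀ (f : ℕ → ℕ) n → (∀ j → j < n → f j ≡ 0) → ∑[ j < n ] f j ≡ 0
  ≡0⇒∑≡0 f zero    f≡0 = refl
  ≡0⇒∑≡0 f (suc n) f≡0 = cong₂ _+_ (≡0⇒∑≡0 f n (λ j j<n → f≡0 j (m<n⇒m<1+n j<n))) (f≡0 n ≤-refl)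

  ∑≡0⇒≡0 : ∀ (f : ℕ → ℕ) n → ∑[ j < n ] f j ≡ 0 → ∀ {j} → j < n → f j ≡ 0
  ∑≡0⇒≡0 f (suc n) ∑≡0 j<1+n with m≤n⇒m<n∨m≡n (≤-pred j<1+n)
  ... | inj₁ j<n  = ∑≡0⇒≡0 f n (m+n≡0⇒m≡0 _ ∑≡0) j<n
  ... | inj₂ refl = m+n≡0⇒n≡0 (∑[ j < n ] f j) ∑≡0

  ∑<n⇒∃≡0 : ∀ (f : ℕ → ℕ) n → ∑[ j < n ] f j < n → ∃ λ j → j < n × f j ≡ 0
  ∑<n⇒∃≡0 f (suc n) ∑<1+n with f n in fn≡
  ... | zero  = n , ≤-refl , fn≡
  ... | suc x with ∑<n⇒∃≡0 f n (<-≤-trans (m<m+n _ z<s) (≤-pred ∑<1+n))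
  ...   | j , j<n , fj≡0 = j , m<n⇒m<1+n j<n , fj≡0

  -- Σ_{i<P} 1/((i+1)(i+2)) = P/(P+1), with the denominators cleared.
  ∑-telescoping : ∀ (c : ℕ → ℕ) M → (∀ i → suc i * (2 + i) * c i ≤ M) →
                  ∀ P → suc P * ∑[ i < P ] c i ≤ P * M
  ∑-telescoping c M c≤ zero    = z≤n
  ∑-telescoping c M c≤ (suc P) = *-cancelˡ-≤ (suc P) (begin
    suc P * ((2 + P) * (S + c P))                    ≡⟨ expand P S (c P) ⟩
    (2 + P) * (suc P * S) + suc P * (2 + P) * c P    ≤⟨ +-mono-≤ (*-monoʳ-≤ (2 + P) (∑-telescoping c M c≤ P)) (c≤ P) ⟩
    (2 + P) * (P * M) + M                            ≡⟨ collect P M ⟩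
    suc P * (suc P * M)                              ∎)
    where
    open ≤-Reasoning
    S = ∑[ i < P ] c i
    expand : ∀ P S c → suc P * ((2 + P) * (S + c)) ≡ (2 + P) * (suc P * S) + suc P * (2 + P) * c
    expand = solve-∀
    collect : ∀ P M → (2 + P) * (P * M) + M ≡ suc P * (suc P * M)
    collect = solve-∀

module Counting where

  open import Data.Nat
  open import Data.Nat.Properties
  open import Data.Nat.DivMod using (_/_; m≡m%n+[m/n]*n; m%n<n)
  open import Function using (_∘_)
  open import Level using (0ℓ)
  open import Relation.Binary.PropositionalEquality
  open import Relation.Nullary using (Dec; yes; no; ¬_; contradiction)
  open import Relation.Unary using (Pred; Decidable)
  open Sums

  𝟙 : {A : Set} → Dec A → ℕ
  𝟙 (yes _) = 1
  𝟙 (no  _) = 0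

  𝟙≡0⇒¬ : ∀ {A : Set} (a? : Dec A) → 𝟙 a? ≡ 0 → ¬ A
  𝟙≡0⇒¬ (no ¬a) _ = ¬a

  count : {P : Pred ℕ 0ℓ} → Decidable P → ℕ → ℕ → ℕ
  count P? b n = ∑[ j < n ] 𝟙 (P? (b + j))

  Separated : ℕ → Pred ℕ 0ℓ → Set
  Separated q P = ∀ {x y} → x < y → P x → P y → x + q ≤ y

  module _ {P : Pred ℕ 0ℓ} (P? : Decidable P) {q} (sep : Separated q P) where

    count-block : ∀ b {K} → K ≤ q → count P? b K ≤ 1
    count-block b {zero}  _     = z≤n
    count-block b {suc K} 1+K≤q with P? (b + K)
    ... | no  _  = subst (_≤ 1) (sym (+-identityʳ _)) (count-block b (<⇒≤ 1+K≤q))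
    ... | yes pK = subst (λ c → c + 1 ≤ 1) (sym (≡0⇒∑≡0 _ K no-earlier-hit)) ≤-refl
      where
      no-earlier-hit : ∀ j → j < K → 𝟙 (P? (b + j)) ≡ 0
      no-earlier-hit j j<K with P? (b + j)
      ... | no  _  = refl
      ... | yes pj = contradiction (sep (+-monoʳ-< b j<K) pj pK) (<⇒≱ (begin-strict
          b + K        <⟨ +-monoʳ-< b 1+K≤q ⟩
          b + q        ≤⟨ +-monoˡ-≤ q (m≤m+n b j) ⟩
          b + j + q    ∎))
        where open ≤-Reasoning

    count-blocks : ∀ t b → count P? b (t * q) ≤ t
    count-blocks zero    b = z≤n
    count-blocks (suc t) b = begin
      count P? b (q + t * q)                               ≡⟨ ∑-++ _ q (t * q) ⟩
      count P? b q + ∑[ j < t * q ] 𝟙 (P? (b + (q + j)))   ≡⟨ cong (count P? b q +_) (∑-cong (t * q) shift) ⟩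
      count P? b q + count P? (b + q) (t * q)              ≤⟨ +-mono-≤ (count-block b ≤-refl) (count-blocks t (b + q)) ⟩
      suc t                                                ∎
      where
      open ≤-Reasoning
      shift : ∀ j → 𝟙 (P? (b + (q + j))) ≡ 𝟙 (P? (b + q + j))
      shift j = cong (𝟙 ∘ P?) (sym (+-assoc b q j))

    count-≤ : .{{_ : NonZero q}} → ∀ b n → count P? b n ≤ suc (n / q)
    count-≤ b n = ≤-trans (∑-≤-longer _ (<⇒≤ n<[1+n/q]*q)) (count-blocks (suc (n / q)) b)
      where
      n<[1+n/q]*q : n < suc (n / q) * q
      n<[1+n/q]*q = subst (_< suc (n / q) * q) (sym (m≡m%n+[m/n]*n n q)) (+-monoˡ-< ((n / q) * q) (m%n<n n q))

module OddNumbers where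

  open import Data.Nat
  open import Data.Nat.Properties
  open import Data.Nat.Divisibility
    using (_∣_; divides; ∣⇒≤; ∣-trans; *-pres-∣; m∣m*n; ∣m+n∣m⇒∣n; 0∣⇒≡0; _∣0)
  open import Data.Nat.Coprimality using (Coprime; coprime-divisor; coprime-factors)
  import Data.Nat.Coprimality as Coprime
  open import Data.Nat.Tactic.RingSolver using (solve-∀)
  open import Data.Product using (∃; _,_)
  open import Data.Sum using (_⊎_; inj₁; inj₂)
  open import Relation.Binary.PropositionalEquality
  open import Relation.Nullary using (yes; no; ¬_; contradiction)
  open Counting using (Separated)

  even⊎odd : ∀ n → (∃ λ s → n ≡ 2 * s) ⊎ (∃ λ s → n ≡ 1 + 2 * s)
  even⊎odd zero    = inj₁ (0 , refl)
  even⊎odd (suc n) with even⊎odd n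
  ... | inj₁ (s , refl) = inj₂ (s , refl)
  ... | inj₂ (s , refl) = inj₁ (suc s , cong suc (sym (+-suc s (s + 0))))

  2∤odd : ∀ t → ¬ 2 ∣ 1 + 2 * t
  2∤odd t (divides c 1+2t≡c*2) = even≢odd c t (trans (*-comm 2 c) (sym 1+2t≡c*2))

  odd-coprime-2 : ∀ t → Coprime (1 + 2 * t) 2
  odd-coprime-2 t {0}                 (_      , 0∣2) = contradiction (0∣⇒≡0 0∣2) λ ()
  odd-coprime-2 t {1}                 _              = refl
  odd-coprime-2 t {2}                 (2∣1+2t , _)   = contradiction 2∣1+2t (2∤odd t)
  odd-coprime-2 t {suc (suc (suc d))} (_      , d∣2) = contradiction (∣⇒≤ d∣2) λ { (s≤s (s≤s ())) }

  consecutive-odd-coprime : ∀ t → Coprime (1 + 2 * t) (1 + 2 * suc t)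
  consecutive-odd-coprime t {d} (d∣x , d∣x+2) =
    odd-coprime-2 t (d∣x , ∣m+n∣m⇒∣n (subst (d ∣_) (plus-two t) d∣x+2) d∣x)
    where
    plus-two : ∀ t → 1 + 2 * suc t ≡ (1 + 2 * t) + 2
    plus-two = solve-∀

  coprime-square : ∀ {a b} → Coprime a b → Coprime (a * a) b
  coprime-square {a} a⊥b (d∣aa , d∣b) =
    a⊥b (coprime-factors (Coprime.sym a⊥b) (∣-trans d∣b (m∣m*n a) , d∣aa) , d∣b)

  odd-multiples-separated : ∀ {q} → Coprime q 2 → Separated q (λ x → q ∣ 1 + 2 * x)
  odd-multiples-separated {q} q⊥2 {x} {y} x<y q∣1+2x q∣1+2y =
    subst (_≤ y) (+-comm q x) (≤-trans (+-monoˡ-≤ x q≤y∸x) (≤-reflexive (m∸n+n≡m (<⇒≤ x<y))))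
    where
    split : (1 + 2 * x) + 2 * (y ∸ x) ≡ 1 + 2 * y
    split = cong suc (trans (sym (*-distribˡ-+ 2 x (y ∸ x))) (cong (2 *_) (m+[n∸m]≡n (<⇒≤ x<y))))
    q≤y∸x : q ≤ y ∸ x
    q≤y∸x = ∣⇒≤ ⦃ >-nonZero (m<n⇒0<n∸m x<y) ⦄
                (coprime-divisor q⊥2 (∣m+n∣m⇒∣n (subst (q ∣_) (sym split) q∣1+2y) q∣1+2x))

  squarefree-* : ∀ {x y} → Coprime x y → SquareFree x → SquareFree y → SquareFree (x * y)
  squarefree-* {x} {y} x⊥y sf-x sf-y p pp∣xy = sf-y p (coprime-divisor (coprime-square p⊥x) pp∣xy)
    where
    p⊥x : Coprime p x
    p⊥x {d} (d∣p , d∣x) = sf-x d (coprime-divisor (coprime-square d⊥y) dd∣yx)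
      where
      d⊥y : Coprime d y
      d⊥y (e∣d , e∣y) = x⊥y (∣-trans e∣d d∣x , e∣y)
      dd∣yx : d * d ∣ y * x
      dd∣yx = subst (d * d ∣_) (*-comm x y) (∣-trans (*-pres-∣ d∣p d∣p) pp∣xy)

  oddSquare : ℕ → ℕ
  oddSquare t = (1 + 2 * t) * (1 + 2 * t)

  odd-squarefree : ∀ P {x} → ¬ 2 ∣ x → x < oddSquare (suc P) →
                   (∀ i → i < P → ¬ oddSquare (suc i) ∣ x) → SquareFree x
  odd-squarefree P {x} 2∤x x<bound sieved p pp∣x with even⊎odd p
  ... | inj₁ (s , refl)     = contradiction (∣-trans (∣-trans (m∣m*n s) (m∣m*n (2 * s))) pp∣x) 2∤x
  ... | inj₂ (zero  , refl) = refl
  ... | inj₂ (suc i , refl) with i <? P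
  ...   | yes i<P = contradiction pp∣x (sieved i i<P)
  ...   | no  i≮P = contradiction (∣⇒≤ ⦃ x≢0 ⦄ pp∣x) (<⇒≱ (<-≤-trans x<bound (*-mono-≤ larger larger)))
    where
    x≢0 : NonZero x
    x≢0 = ≢-nonZero λ { refl → 2∤x (2 ∣0) }
    larger : 1 + 2 * suc P ≤ 1 + 2 * suc i
    larger = s≤s (*-monoʳ-≤ 2 (s≤s (≮⇒≥ i≮P)))

module Sieve (P b : ℕ) where

  open import Data.Nat
  open import Data.Nat.Properties
  open import Data.Nat.DivMod using (_/_; m/n*n≤m)
  open import Data.Nat.Divisibility using (_∣_; _∣?_)
  open import Data.Nat.Tactic.RingSolver using (solve-∀)
  open import Data.Product using (∃; _×_; _,_)
  open import Relation.Binary.PropositionalEquality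
  open import Relation.Nullary using (¬_)
  open Sums
  open Counting
  open OddNumbers using (oddSquare; odd-coprime-2; coprime-square; odd-multiples-separated)

  N : ℕ
  N = 4 * suc P

  q : ℕ → ℕ
  q i = oddSquare (suc i)

  hit : ℕ → ℕ → ℕ
  hit i x = 𝟙 (q i ∣? 1 + 2 * x)

  hits : ℕ → ℕ → ℕ
  hits i c = count (λ x → q i ∣? 1 + 2 * x) c N

  bad : ℕ → ℕ
  bad j = ∑[ i < P ] (hit i (b + j) + hit i (suc b + j))

  excess : ℕ → ℕ
  excess i = (hits i b ∸ 1) + (hits i (suc b) ∸ 1)

  q*[hits-1]≤N : ∀ i c → q i * (hits i c ∸ 1) ≤ N
  q*[hits-1]≤N i c = begin
    q i * (hits i c ∸ 1)   ≤⟨ *-monoʳ-≤ (q i) (m≤n+o⇒m∸n≤o (hits i c) 1 hits≤1+N/q) ⟩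
    q i * (N / q i)        ≡⟨ *-comm (q i) (N / q i) ⟩
    (N / q i) * q i        ≤⟨ m/n*n≤m N (q i) ⟩
    N                      ∎
    where
    open ≤-Reasoning
    hits≤1+N/q : hits i c ≤ suc (N / q i)
    hits≤1+N/q = count-≤ (λ x → q i ∣? 1 + 2 * x) (odd-multiples-separated (coprime-square (odd-coprime-2 (suc i)))) c N

  excess-bound : ∀ i → suc i * (2 + i) * excess i ≤ 2 * suc P
  excess-bound i = *-cancelˡ-≤ 4 (begin
    4 * (suc i * (2 + i) * excess i)                   ≡⟨ *-assoc 4 (suc i * (2 + i)) (excess i) ⟨
    4 * (suc i * (2 + i)) * excess i                   ≤⟨ *-monoˡ-≤ (excess i) (m≤n+m (4 * (suc i * (2 + i))) 1) ⟩
    (1 + 4 * (suc i * (2 + i))) * excess i             ≡⟨ cong (_* excess i) (odd-square i) ⟨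
    q i * excess i                                     ≡⟨ *-distribˡ-+ (q i) (hits i b ∸ 1) (hits i (suc b) ∸ 1) ⟩
    q i * (hits i b ∸ 1) + q i * (hits i (suc b) ∸ 1)  ≤⟨ +-mono-≤ (q*[hits-1]≤N i b) (q*[hits-1]≤N i (suc b)) ⟩
    N + N                                              ≡⟨ double P ⟩
    4 * (2 * suc P)                                    ∎)
    where
    open ≤-Reasoning
    odd-square : ∀ i → (1 + 2 * suc i) * (1 + 2 * suc i) ≡ 1 + 4 * (suc i * (2 + i))
    odd-square = solve-∀
    double : ∀ P → 4 * suc P + 4 * suc P ≡ 4 * (2 * suc P)
    double = solve-∀

  ∑excess≤2P : ∑[ i < P ] excess i ≤ 2 * P
  ∑excess≤2P = *-cancelˡ-≤ (suc P) (≤-trans (∑-telescoping excess (2 * suc P) excess-bound P) (≤-reflexive (swap P)))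
    where
    swap : ∀ P → P * (2 * suc P) ≡ suc P * (2 * P)
    swap = solve-∀

  ∑bad≡∑hits : ∑[ j < N ] bad j ≡ ∑[ i < P ] (hits i b + hits i (suc b))
  ∑bad≡∑hits = trans (sym (∑-comm (λ i j → hit i (b + j) + hit i (suc b + j)) P N))
                     (∑-cong P (λ i → ∑-distrib-+ (λ j → hit i (b + j)) (λ j → hit i (suc b + j)) N))

  hits≤2+excess : ∀ i → hits i b + hits i (suc b) ≤ 2 + excess i
  hits≤2+excess i = ≤-trans (+-mono-≤ (m≤n+m∸n (hits i b) 1) (m≤n+m∸n (hits i (suc b)) 1))
                            (≤-reflexive (regroup (hits i b ∸ 1) (hits i (suc b) ∸ 1)))
    where
    regroup : ∀ a c → (1 + a) + (1 + c) ≡ 2 + (a + c)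
    regroup = solve-∀

  ∑bad<N : ∑[ j < N ] bad j < N
  ∑bad<N = begin-strict
    ∑[ j < N ] bad j                         ≡⟨ ∑bad≡∑hits ⟩
    ∑[ i < P ] (hits i b + hits i (suc b))   ≤⟨ ∑-mono-≤ P (λ i _ → hits≤2+excess i) ⟩
    ∑[ i < P ] (2 + excess i)                ≡⟨ ∑-distrib-+ (λ _ → 2) excess P ⟩
    ∑[ i < P ] 2 + ∑[ i < P ] excess i       ≡⟨ cong (_+ ∑[ i < P ] excess i) (∑-const P 2) ⟩
    P * 2 + ∑[ i < P ] excess i              ≤⟨ +-monoʳ-≤ (P * 2) ∑excess≤2P ⟩
    P * 2 + 2 * P                            <⟨ m<m+n (P * 2 + 2 * P) {4} z<s ⟩
    P * 2 + 2 * P + 4                        ≡⟨ collect P ⟩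
    N                                        ∎
    where
    open ≤-Reasoning
    collect : ∀ P → P * 2 + 2 * P + 4 ≡ 4 * suc P
    collect = solve-∀

  bad≡0⇒sieved : ∀ j → bad j ≡ 0 → ∀ i → i < P → ¬ q i ∣ 1 + 2 * (b + j) × ¬ q i ∣ 1 + 2 * suc (b + j)
  bad≡0⇒sieved j bad≡0 i i<P =
    𝟙≡0⇒¬ (q i ∣? 1 + 2 * (b + j)) (m+n≡0⇒m≡0 (hit i (b + j)) hits≡0) ,
    𝟙≡0⇒¬ (q i ∣? 1 + 2 * (suc b + j)) (m+n≡0⇒n≡0 (hit i (b + j)) hits≡0)
    where
    hits≡0 : hit i (b + j) + hit i (suc b + j) ≡ 0
    hits≡0 = ∑≡0⇒≡0 (λ i → hit i (b + j) + hit i (suc b + j)) P bad≡0 i<P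

  sieve : ∃ λ j → j < N × (∀ i → i < P → ¬ q i ∣ 1 + 2 * (b + j) × ¬ q i ∣ 1 + 2 * suc (b + j))
  sieve = let j , j<N , bad≡0 = ∑<n⇒∃≡0 bad N ∑bad<N in j , j<N , bad≡0⇒sieved j bad≡0

module QuadraticUnits where

  open import Data.Integer
  open import Data.Integer.Properties
  open import Data.Integer.Tactic.RingSolver using (solve-∀)
  import Data.Nat as ℕ
  import Data.Nat.Properties as ℕ
  open import Data.Product using (_×_; _,_; proj₁; proj₂)
  open import Data.Sum using (_⊎_; inj₁; inj₂)
  open import Data.Empty using (⊥-elim)
  open import Relation.Binary.PropositionalEquality
  open import Relation.Nullary using (¬_; yes; no; contradiction)

  norm : ℤ → ℤ√ → ℤ
  norm d (a , b) = a * a - d * b * b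

  norm-mul : ∀ d x y → norm d (mul√ d x y) ≡ norm d x * norm d y
  norm-mul d (a , b) (c , e) = brahmagupta a b c e d
    where
    brahmagupta : ∀ a b c e d → (a * c + d * b * e) * (a * c + d * b * e) - d * (a * e + b * c) * (a * e + b * c)
                              ≡ (a * a - d * b * b) * (c * c - d * e * e)
    brahmagupta = solve-∀

  norm-one : ∀ d → norm d one√ ≡ + 1
  norm-one d = cong (λ z → + 1 - z * + 0) (*-zeroʳ d)

  ∣i∣≡1⇒i≡±1 : ∀ i → ∣ i ∣ ≡ 1 → i ≡ + 1 ⊎ i ≡ - + 1
  ∣i∣≡1⇒i≡±1 (+ _)     refl = inj₁ refl
  ∣i∣≡1⇒i≡±1 -[1+ _ ] refl = inj₂ refl

  unit⇒norm≡±1 : ∀ {d x} → IsUnit d x → norm d x ≡ + 1 ⊎ norm d x ≡ - + 1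
  unit⇒norm≡±1 {d} {x} (y , xy≡1) =
    ∣i∣≡1⇒i≡±1 (norm d x) (ℕ.m*n≡1⇒m≡1 _ _ (trans (sym (abs-* (norm d x) (norm d y))) (cong ∣_∣ Nx*Ny≡1)))
    where
    Nx*Ny≡1 : norm d x * norm d y ≡ + 1
    Nx*Ny≡1 = trans (sym (norm-mul d x y)) (trans (cong (norm d) xy≡1) (norm-one d))

  unit⇒-1≤norm≤1 : ∀ {d x} → IsUnit d x → - + 1 ≤ norm d x × norm d x ≤ + 1
  unit⇒-1≤norm≤1 {d} {x} u with unit⇒norm≡±1 {d} {x} u
  ... | inj₁ N≡1  = subst (- + 1 ≤_) (sym N≡1) -≤+ , ≤-reflexive N≡1
  ... | inj₂ N≡-1 = ≤-reflexive (sym N≡-1) , subst (_≤ + 1) (sym N≡-1) -≤+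

  -- The contradictions below are certificates: nonnegative quantities whose sum is,
  -- as a polynomial identity, a negative constant.
  0≤i⇒i≢-[1+n] : ∀ {i} n → + 0 ≤ i → i ≢ -[1+ n ]
  0≤i⇒i≢-[1+n] n () refl

  0≤+ : ∀ k → + 0 ≤ + k
  0≤+ k = +≤+ ℕ.z≤n

  0≤-+ : ∀ {i j} → + 0 ≤ i → + 0 ≤ j → + 0 ≤ i + j
  0≤-+ = +-mono-≤

  0≤-* : ∀ {i j} → + 0 ≤ i → + 0 ≤ j → + 0 ≤ i * j
  0≤-* {+ m} {+ n} _ _ = subst (+ 0 ≤_) (pos-* m n) (0≤+ (m ℕ.* n))

  0<i⇒0≤i-1 : ∀ {i} → + 0 < i → + 0 ≤ i - + 1
  0<i⇒0≤i-1 0<i = i≤j⇒0≤j-i (i<j⇒suc[i]≤j 0<i)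

  i<j⇒0≤j-[1+i] : ∀ {i j} → i < j → + 0 ≤ j - (+ 1 + i)
  i<j⇒0≤j-[1+i] i<j = i≤j⇒0≤j-i (i<j⇒suc[i]≤j i<j)

  module _ {d a b : ℤ} (unit : IsUnit d (a , b)) where

    private
      0≤1-N : + 0 ≤ + 1 - (a * a - d * b * b)
      0≤1-N = i≤j⇒0≤j-i (proj₂ (unit⇒-1≤norm≤1 {d} {a , b} unit))

      0≤N+1 : + 0 ≤ (a * a - d * b * b) + + 1
      0≤N+1 = i≤j⇒0≤j-i (proj₁ (unit⇒-1≤norm≤1 {d} {a , b} unit))

    unit>1⇒coefficients≥1 : (a , b) >[ d ] one√ → + 1 ≤ a × + 1 ≤ b
    unit>1⇒coefficients≥1 (inj₁ (0≤a-1 , 0≤b-0 , ¬a-1≡0∧b≡0)) with b ≟ + 0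
    ... | no  b≢0  = 0≤i-j⇒j≤i 0≤a-1 ,
                     i<j⇒suc[i]≤j (≤∧≢⇒< (subst (+ 0 ≤_) (+-identityʳ b) 0≤b-0) (λ 0≡b → b≢0 (sym 0≡b)))
    ... | yes refl = ⊥-elim (0≤i⇒i≢-[1+n] 2 (0≤-+ (0≤-+ 0≤1-N (0≤-* 0≤a-2 0≤a-2)) (0≤-* (0≤+ 4) 0≤a-2))
                                           (certificate a d))
      where
      0≤a-2 : + 0 ≤ (a - + 1) - + 1
      0≤a-2 = 0<i⇒0≤i-1 (≤∧≢⇒< 0≤a-1 (λ 0≡a-1 → ¬a-1≡0∧b≡0 (sym 0≡a-1 , refl)))
      certificate : ∀ a d → (+ 1 - (a * a - d * + 0 * + 0)) + ((a - + 1) - + 1) * ((a - + 1) - + 1)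
                              + + 4 * ((a - + 1) - + 1) ≡ - + 3
      certificate = solve-∀
    unit>1⇒coefficients≥1 (inj₂ (inj₁ (0<a-1 , _ , d[b-0]²<[a-1]²))) =
      ⊥-elim (0≤i⇒i≢-[1+n] 2 (0≤-+ (0≤-+ 0≤1-N (i<j⇒0≤j-[1+i] d[b-0]²<[a-1]²)) (0≤-+ 0≤a-2 0≤a-2))
                             (certificate a b d))
      where
      0≤a-2 : + 0 ≤ (a - + 1) - + 1
      0≤a-2 = 0<i⇒0≤i-1 0<a-1
      certificate : ∀ a b d → (+ 1 - (a * a - d * b * b)) + ((a - + 1) * (a - + 1) - (+ 1 + d * (b - + 0) * (b - + 0)))
                                + (((a - + 1) - + 1) + ((a - + 1) - + 1)) ≡ - + 3
      certificate = solve-∀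
    unit>1⇒coefficients≥1 (inj₂ (inj₂ (a-1<0 , _ , [a-1]²<d[b-0]²))) =
      ⊥-elim (0≤i⇒i≢-[1+n] 0 (0≤-+ (0≤-+ 0≤N+1 (i<j⇒0≤j-[1+i] [a-1]²<d[b-0]²)) (0≤-+ 0≤-a 0≤-a))
                             (certificate a b d))
      where
      0≤-a : + 0 ≤ + 0 - (+ 1 + (a - + 1))
      0≤-a = i<j⇒0≤j-[1+i] a-1<0
      certificate : ∀ a b d → ((a * a - d * b * b) + + 1) + (d * (b - + 0) * (b - + 0) - (+ 1 + (a - + 1) * (a - + 1)))
                                + ((+ 0 - (+ 1 + (a - + 1))) + (+ 0 - (+ 1 + (a - + 1)))) ≡ - + 1
      certificate = solve-∀

  below[w+√d]⇒a<w : ∀ {d w a b} → + 1 ≤ b → (w , + 1) >[ d ] (a , b) → + 0 < w - a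
  below[w+√d]⇒a<w 1≤b (inj₁ (0≤w-a , 0≤1-b , ¬w-a≡0∧1-b≡0)) =
    ≤∧≢⇒< 0≤w-a (λ 0≡w-a → ¬w-a≡0∧1-b≡0 (sym 0≡w-a , ≤-antisym (i≤j⇒i-j≤0 1≤b) 0≤1-b))
  below[w+√d]⇒a<w 1≤b (inj₂ (inj₁ (0<w-a , _))) = 0<w-a
  below[w+√d]⇒a<w 1≤b (inj₂ (inj₂ (_ , 0<1-b , _))) = contradiction (<-≤-trans 0<1-b (i≤j⇒i-j≤0 1≤b)) (<-irrefl refl)

  1≤a<w⇒norm<-1 : ∀ {w a b} → + 1 ≤ a → + 0 < w - a → + 1 ≤ b → norm (w * w - + 1) (a , b) < - + 1
  1≤a<w⇒norm<-1 {w} {a} {b} 1≤a 0<w-a 1≤b = ≰⇒> λ -1≤N → 0≤i⇒i≢-[1+n] 0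
    (0≤-+ (0≤-+ (0≤-+ (i≤j⇒0≤j-i -1≤N) (0≤-* Y (0≤-+ (0≤-+ Y (0≤-+ X X)) (0≤+ 2))))
                 (0≤-* (0≤-* (0≤-* W (0≤-+ W (0≤+ 2))) Z) (0≤-+ Z (0≤+ 2))))
          (0≤-+ (0≤-+ X X) (0≤-+ Y Y)))
    (certificate a b w)
    where
    X : + 0 ≤ a - + 1
    X = i≤j⇒0≤j-i 1≤a
    Y : + 0 ≤ (w - a) - + 1
    Y = 0<i⇒0≤i-1 0<w-a
    Z : + 0 ≤ b - + 1
    Z = i≤j⇒0≤j-i 1≤b
    W : + 0 ≤ w - + 1
    W = i≤j⇒0≤j-i (≤-trans 1≤a (0≤i-j⇒j≤i {w} (<⇒≤ 0<w-a)))
    certificate : ∀ a b w →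
      (a * a - (w * w - + 1) * b * b) + + 1 + ((w - a) - + 1) * ((((w - a) - + 1) + ((a - + 1) + (a - + 1))) + + 2)
        + (w - + 1) * ((w - + 1) + + 2) * (b - + 1) * ((b - + 1) + + 2)
        + (((a - + 1) + (a - + 1)) + (((w - a) - + 1) + ((w - a) - + 1))) ≡ - + 1
    certificate = solve-∀

  fundamental-unit : ∀ w → + 1 ≤ w → IsFundamentalUnit (w * w - + 1) (w , + 1)
  fundamental-unit w 1≤w = ε-unit , ε>1 , ε-minimal
    where
    d = w * w - + 1

    ε-unit : IsUnit d (w , + 1)
    ε-unit = (w , - + 1) , cong₂ _,_ (norm≡1 w) (conjugate w)
      where
      norm≡1 : ∀ w → w * w + (w * w - + 1) * + 1 * - + 1 ≡ + 1
      norm≡1 = solve-∀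
      conjugate : ∀ w → w * - + 1 + + 1 * w ≡ + 0
      conjugate = solve-∀

    ε>1 : (w , + 1) >[ d ] one√
    ε>1 = inj₁ (i≤j⇒0≤j-i 1≤w , 0≤+ 1 , λ ())

    ε-minimal : ∀ u → IsUnit d u → u >[ d ] one√ → ¬ (w , + 1) >[ d ] u
    ε-minimal (a , b) unit u>1 ε>u with unit>1⇒coefficients≥1 {d} {a} {b} unit u>1
    ... | 1≤a , 1≤b = <⇒≱ (1≤a<w⇒norm<-1 {w} 1≤a (below[w+√d]⇒a<w {d} {w} {a} 1≤b ε>u) 1≤b)
                           (proj₁ (unit⇒-1≤norm≤1 {d} {a , b} unit))

open import Data.Nat using (ℕ; _<_; suc; _+_; _*_; _∸_; z≤n; s≤s; z<s)
open import Data.Nat.Properties using (m≤m+n; m<m+n; n<1+n; <-trans; +-monoʳ-<; *-monoʳ-≤; *-monoʳ-<; module ≤-Reasoning)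
open import Data.Nat.Tactic.RingSolver using (solve-∀)
open import Data.Integer using (+_)
import Data.Integer as ℤ
open import Data.Integer.Properties using (⊖-≥; m-n≡m⊖n; pos-*)
open import Data.Product using (_×_; ∃; _,_; proj₁; proj₂)
open import Relation.Binary.PropositionalEquality
open import Relation.Nullary using (¬_)
open import Data.Nat.Divisibility using (_∣_)
open OddNumbers
open QuadraticUnits using (fundamental-unit)

dOf-suc : ∀ k → dOf (suc k) ≡ (1 + 2 * k) * (1 + 2 * suc k)
dOf-suc k = cong (_∸ 1) (square k)
  where
  square : ∀ k → 4 * suc k * suc k ≡ suc ((1 + 2 * k) * (1 + 2 * suc k))
  square = solve-∀

+dOf-suc : ∀ k → + dOf (suc k) ≡ + (2 * suc k) ℤ.* + (2 * suc k) ℤ.- + 1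
+dOf-suc k = begin
  + dOf (suc k)          ≡⟨ cong (λ n → + (n ∸ 1)) (square k) ⟩
  + (W * W ∸ 1)          ≡⟨ ⊖-≥ (s≤s z≤n) ⟨
  W * W ℤ.⊖ 1            ≡⟨ m-n≡m⊖n (W * W) 1 ⟨
  + (W * W) ℤ.- + 1      ≡⟨ cong (ℤ._- + 1) (pos-* W W) ⟩
  + W ℤ.* + W ℤ.- + 1    ∎
  where
  open ≡-Reasoning
  W = 2 * suc k
  square : ∀ k → 4 * suc k * suc k ≡ 2 * suc k * (2 * suc k)
  square = solve-∀

squarefree-dOf : ∀ P k → 1 + 2 * suc k < oddSquare (suc P) →
                 (∀ i → i < P → ¬ oddSquare (suc i) ∣ 1 + 2 * k × ¬ oddSquare (suc i) ∣ 1 + 2 * suc k) →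
                 SquareFree (dOf (suc k))
squarefree-dOf P k y<bound sieved =
  subst SquareFree (sym (dOf-suc k))
        (squarefree-* (consecutive-odd-coprime k)
                      (odd-squarefree P (2∤odd k) x<bound (λ i i<P → proj₁ (sieved i i<P)))
                      (odd-squarefree P (2∤odd (suc k)) y<bound (λ i i<P → proj₂ (sieved i i<P))))
  where
  x<bound : 1 + 2 * k < oddSquare (suc P)
  x<bound = <-trans (s≤s (*-monoʳ-< 2 (n<1+n k))) y<bound

fundamental-εOf : ∀ k → IsFundamentalUnit (+ dOf (suc k)) (εOf (suc k))
fundamental-εOf k = subst (λ d → IsFundamentalUnit d (εOf (suc k))) (sym (+dOf-suc k))
                          (fundamental-unit (+ (2 * suc k)) (ℤ.+≤+ (s≤s z≤n)))

window-bound : ∀ m j → j < 4 * (2 + m) → 1 + 2 * suc (m + j) < oddSquare (2 + m)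
window-bound m j j<N = begin-strict
  1 + 2 * suc (m + j)                                       ≤⟨ s≤s (*-monoʳ-≤ 2 (+-monoʳ-< m j<N)) ⟩
  1 + 2 * (m + 4 * (2 + m))                                 <⟨ m<m+n _ z<s ⟩
  1 + 2 * (m + 4 * (2 + m)) + (8 + 10 * m + 4 * (m * m))    ≡⟨ expand m ⟩
  oddSquare (2 + m)                                         ∎
  where
  open ≤-Reasoning
  expand : ∀ m → 1 + 2 * (m + 4 * (2 + m)) + (8 + 10 * m + 4 * (m * m)) ≡ (1 + 2 * (2 + m)) * (1 + 2 * (2 + m))
  expand = solve-∀

lemma3p20 : ∀ (m : ℕ) → ∃ λ n → m < n × SquareFree (dOf n) × IsFundamentalUnit (+ (dOf n)) (εOf n)
lemma3p20 m =
  let j , j<N , sieved = Sieve.sieve (suc m) m in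
  suc (m + j) , s≤s (m≤m+n m j) ,
  squarefree-dOf (suc m) (m + j) (window-bound m j j<N) sieved , fundamental-εOf (m + j)
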